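{- Let $G$ be a graph with distinct neighbourhoods. If $G$ admits a W-join $(A,B)$, then $(A,B)$ is a proper W-join.
   Context: Graphs are finite, simple, undirected; $N(u)$ is the neighbourhood of $u$. Two adjacent vertices $u,v$ have nested neighbourhoods if $N(u)\setminus\{v\}\subseteq N(v)\setminus\{u\}$ or $N(v)\setminus\{u\}\subseteq N(u)\setminus\{v\}$; $G$ has distinct neighbourhoods if no two vertices have nested neighbourhoods. Disjoint sets $S,T$ are complete if every vertex of $S$ is adjacent to every vertex of $T$ and anticomplete if no edge joins them; a single vertex $x$ is complete/anticomplete to $T$ if $\{x\}$ is. A pair $(A,B)$ of disjoint non-empty vertex sets is a W-join if $|A|+|B|>2$, $A$ and $B$ are cliques, $A$ is neither complete nor anticomplete to $B$, and every vertex of $V(G)\setminus(A\cup B)$ is either complete or anticomplete to $A$ and either complete or anticomplete to $B$. A W-join $(A,B)$ is proper if each vertex of $A$ is neither complete nor anticomplete to $B$ and each vertex of $B$ is neither complete nor anticomplete to $A$. -}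

module Defs where

open import Data.Nat using (ℕ; _+_; _>_)
open import Data.Fin using (Fin)
open import Data.Fin.Subset using (Subset; _∈_; _∉_; ∣_∣)
open import Data.Product using (_×_; ∃)
open import Data.Sum using (_⊎_)
open import Data.Empty using (⊥)
open import Relation.Nullary using (¬_)
open import Relation.Binary.PropositionalEquality using (_≡_; _≢_)

record Graph (n : ℕ) : Set₁ where
  field
    Adj   : Fin n → Fin n → Set
    sym   : ∀ {u v} → Adj u v → Adj v u
    irrefl : ∀ {u} → ¬ Adj u u

module _ {n : ℕ} (G : Graph n) where
  open Graph G

  NbhdSub : Fin n → Fin n → Set
  NbhdSub u v = ∀ w → w ≢ v → w ≢ u → Adj u w → Adj v w

  Nested : Fin n → Fin n → Set
  Nested u v = Adj u v × (NbhdSub u v ⊎ NbhdSub v u)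

  DistinctNbhds : Set
  DistinctNbhds = ∀ u v → ¬ Nested u v

  Clique : Subset n → Set
  Clique S = ∀ u v → u ∈ S → v ∈ S → u ≢ v → Adj u v

  Disjoint : Subset n → Subset n → Set
  Disjoint S T = ∀ x → x ∈ S → x ∈ T → ⊥

  NonEmpty : Subset n → Set
  NonEmpty S = ∃ λ x → x ∈ S

  VComplete : Fin n → Subset n → Set
  VComplete x T = ∀ y → y ∈ T → Adj x y

  VAnticomplete : Fin n → Subset n → Set
  VAnticomplete x T = ∀ y → y ∈ T → ¬ Adj x y

  Complete : Subset n → Subset n → Set
  Complete S T = ∀ x y → x ∈ S → y ∈ T → Adj x y

  Anticomplete : Subset n → Subset n → Set
  Anticomplete S T = ∀ x y → x ∈ S → y ∈ T → ¬ Adj x y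

  record WJoin (A B : Subset n) : Set where
    field
      disjoint  : Disjoint A B
      nonemptyA : NonEmpty A
      nonemptyB : NonEmpty B
      size      : ∣ A ∣ + ∣ B ∣ > 2
      cliqueA   : Clique A
      cliqueB   : Clique B
      notComplete     : ¬ Complete A B
      notAnticomplete : ¬ Anticomplete A B
      outside : ∀ x → x ∉ A → x ∉ B →
        (VComplete x A ⊎ VAnticomplete x A) × (VComplete x B ⊎ VAnticomplete x B)

  ProperWJoin : Subset n → Subset n → Set
  ProperWJoin A B =
    WJoin A B ×
    (∀ a → a ∈ A → ¬ VComplete a B × ¬ VAnticomplete a B) ×
    (∀ b → b ∈ B → ¬ VComplete b A × ¬ VAnticomplete b A)

module Submission where

-- Let X be a clique and Y a set such that every vertex outside X ∪ Y
-- is complete or anticomplete to X (one half of a W-join).  For x, a ∈ X,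
-- a neighbour w of x outside X ∪ Y is adjacent to the member x of X, hence
-- complete to X, hence adjacent to a; neighbours inside X are adjacent to a
-- because X is a clique.  So N(x) \ {a} ⊆ N(a) \ {x} as soon as every
-- neighbour of x in Y is a neighbour of a (`dominated-in-Y⇒NbhdSub`).
-- This hypothesis holds for any x when a is complete to Y, and (vacuously,
-- with the roles of x and a exchanged) for any x when a is anticomplete to Y.
-- With distinct neighbourhoods nested pairs do not exist, so X has no vertex
-- other than a; thus one vertex of X complete (anticomplete) to Y forces X
-- to be complete (anticomplete) to Y, contradicting the W-join axioms.
-- The theorem applies this to (A, B) and to (B, A).

open import Defs
open import Data.Nat using (ℕ)
open import Data.Fin using (_≟_)
open import Data.Fin.Subset using (Subset; _∈_; _∉_)
open import Data.Fin.Subset.Properties using (_∈?_)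
open import Data.Product using (_×_; _,_; proj₁; proj₂)
open import Data.Sum using (_⊎_; inj₁; inj₂)
open import Data.Empty using (⊥-elim)
open import Relation.Nullary using (¬_; yes; no)
open import Relation.Binary.PropositionalEquality using (_≢_; refl; ≢-sym)

module _ {n : ℕ} (G : Graph n) where
  open Graph G

  HomogeneousOutside : Subset n → Subset n → Set
  HomogeneousOutside X Y =
    ∀ w → w ∉ X → w ∉ Y → VComplete G w X ⊎ VAnticomplete G w X

  Complete-sym : ∀ {X Y} → Complete G X Y → Complete G Y X
  Complete-sym c y x yY xX = sym (c x y xX yY)

  Anticomplete-sym : ∀ {X Y} → Anticomplete G X Y → Anticomplete G Y X
  Anticomplete-sym c y x yY xX yx = c x y xX yY (sym yx)

  clique-not-dominated : DistinctNbhds G → ∀ {X} → Clique G X →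
    ∀ {x a} → x ∈ X → a ∈ X → x ≢ a → ¬ NbhdSub G x a
  clique-not-dominated dist clX xX aX x≢a sub =
    dist _ _ (clX _ _ xX aX x≢a , inj₁ sub)

  dominated-in-Y⇒NbhdSub : ∀ {X Y} → Clique G X → HomogeneousOutside X Y →
    ∀ {x a} → x ∈ X → a ∈ X →
    (∀ w → w ∈ Y → Adj x w → Adj a w) → NbhdSub G x a
  dominated-in-Y⇒NbhdSub {X} {Y} clX hom {x} {a} xX aX inY w w≢a w≢x xw
    with w ∈? X | w ∈? Y
  ... | yes wX | _      = clX a w aX wX (≢-sym w≢a)
  ... | no _   | yes wY = inY w wY xw
  ... | no wX  | no wY  with hom w wX wY
  ...   | inj₁ w-complete     = sym (w-complete a aX)
  ...   | inj₂ w-anticomplete = ⊥-elim (w-anticomplete x xX (sym xw))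

  module _ (dist : DistinctNbhds G) {X Y : Subset n}
           (clX : Clique G X) (hom : HomogeneousOutside X Y) where

    vertex-complete⇒complete : ∀ {a} → a ∈ X → VComplete G a Y → Complete G X Y
    vertex-complete⇒complete {a} aX a-complete x y xX yY with x ≟ a
    ... | yes refl = a-complete y yY
    ... | no x≢a   = ⊥-elim (clique-not-dominated dist clX xX aX x≢a
        (dominated-in-Y⇒NbhdSub clX hom xX aX (λ w wY _ → a-complete w wY)))

    vertex-anticomplete⇒anticomplete : ∀ {a} → a ∈ X → VAnticomplete G a Y →
      Anticomplete G X Y
    vertex-anticomplete⇒anticomplete {a} aX a-anti x y xX yY with x ≟ a
    ... | yes refl = a-anti y yY
    ... | no x≢a   = ⊥-elim (clique-not-dominated dist clX aX xX (≢-sym x≢a)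
        (dominated-in-Y⇒NbhdSub clX hom aX xX (λ w wY aw → ⊥-elim (a-anti w wY aw))))

lemma12 : (n : ℕ) (G : Graph n) → DistinctNbhds G →
    (A B : Subset n) → WJoin G A B → ProperWJoin G A B
lemma12 n G dist A B W = W , A-proper , B-proper
  where
  open WJoin W

  homA : HomogeneousOutside G A B
  homA x xA xB = proj₁ (outside x xA xB)

  homB : HomogeneousOutside G B A
  homB x xB xA = proj₂ (outside x xA xB)

  A-proper : ∀ a → a ∈ A → ¬ VComplete G a B × ¬ VAnticomplete G a B
  A-proper a aA =
      (λ c → notComplete (vertex-complete⇒complete G dist cliqueA homA aA c))
    , (λ c → notAnticomplete
               (vertex-anticomplete⇒anticomplete G dist cliqueA homA aA c))

  B-proper : ∀ b → b ∈ B → ¬ VComplete G b A × ¬ VAnticomplete G b A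
  B-proper b bB =
      (λ c → notComplete (Complete-sym G
               (vertex-complete⇒complete G dist cliqueB homB bB c)))
    , (λ c → notAnticomplete (Anticomplete-sym G
               (vertex-anticomplete⇒anticomplete G dist cliqueB homB bB c)))
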